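{- An edge-labelled graph $G$ has an interval ordering if and only if it has a consistent interval representation.
   Context: An edge-labelled graph is a finite graph $G=(V,E)$ with a loop at every vertex, in which every edge is labelled either "inclusion edge" or "overlap edge" (loops are labelled inclusion); labels need not reflect neighbourhoods. A non-edge is a pair of non-adjacent vertices. An interval ordering of $G$ is a linear ordering $<$ of $V$ such that there are no three vertices $a<b<c$ with: (i) $ab$ a non-edge and $ac$ an edge; or (ii) $ab$ an inclusion edge, $ac$ a non-edge, and $bc$ an edge; or (iii) $ab$ an overlap edge, $ac$ an edge, and $bc$ a non-edge; or (iv) $ab$ and $bc$ overlap edges while $ac$ is an inclusion edge; or (v) $ab$ and $bc$ inclusion edges while $ac$ is an overlap edge. An interval representation of $G$ assigns to each vertex a closed interval of the real line so that two distinct vertices are adjacent iff their intervals intersect. It is consistent with the labelling if for any two vertices $u,v$, the interval of $u$ overlaps the interval of $v$ (they intersect and neither contains the other) iff $uv$ is an overlap edge.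
   Formalization: The closed intervals in the consistent interval representation have rational endpoints instead of arbitrary real endpoints. -}

module Defs where

open import Data.Nat using (ℕ)
open import Data.Fin using (Fin)
import Data.Fin as F
open import Data.Fin.Permutation using (Permutation′; _⟨$⟩ʳ_)
open import Data.Maybe using (Maybe; just; nothing)
open import Data.Product using (_×_; ∃)
open import Data.Empty using (⊥)
open import Relation.Nullary using (¬_)
open import Relation.Binary.PropositionalEquality using (_≡_; _≢_)
open import Data.Rational using (ℚ; _≤_)

data Label : Set where
  incl ovl : Label

-- A finite edge-labelled graph on vertex set Fin n.
-- lab u v = nothing : non-edge; just incl : inclusion edge; just ovl : overlap edge.
record ELGraph (n : ℕ) : Set where
  field
    lab   : Fin n → Fin n → Maybe Label
    lab-sym  : ∀ u v → lab u v ≡ lab v u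
    lab-loop : ∀ v → lab v v ≡ just incl

module _ {n : ℕ} (G : ELGraph n) where
  open ELGraph G

  Edge : Fin n → Fin n → Set
  Edge u v = ∃ λ l → lab u v ≡ just l

  NonEdge : Fin n → Fin n → Set
  NonEdge u v = lab u v ≡ nothing

  InclEdge : Fin n → Fin n → Set
  InclEdge u v = lab u v ≡ just incl

  OvlEdge : Fin n → Fin n → Set
  OvlEdge u v = lab u v ≡ just ovl

  -- the forbidden patterns (i)-(v) for a triple a < b < c
  Forbidden : Fin n → Fin n → Fin n → Set
  Forbidden a b c =
      (NonEdge a b × Edge a c)
    ⊎ (InclEdge a b × NonEdge a c × Edge b c)
    ⊎ (OvlEdge a b × Edge a c × NonEdge b c)
    ⊎ (OvlEdge a b × OvlEdge b c × InclEdge a c)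
    ⊎ (InclEdge a b × InclEdge b c × OvlEdge a c)
    where open import Data.Sum using (_⊎_)

  -- A linear ordering of V is given by a permutation π assigning positions;
  -- u precedes v iff π u < π v.
  _≺[_]_ : Fin n → Permutation′ n → Fin n → Set
  u ≺[ π ] v = (π ⟨$⟩ʳ u) F.< (π ⟨$⟩ʳ v)

  IsIntervalOrdering : Permutation′ n → Set
  IsIntervalOrdering π =
    ∀ a b c → a ≺[ π ] b → b ≺[ π ] c → ¬ Forbidden a b c

  HasIntervalOrdering : Set
  HasIntervalOrdering = ∃ λ π → IsIntervalOrdering π

record Interval : Set where
  constructor [_,_∣_]
  field
    left  : ℚ
    right : ℚ
    left≤right : left ≤ right
open Interval public

Intersect : Interval → Interval → Set
Intersect I J = (left I ≤ right J) × (left J ≤ right I)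

Contained : Interval → Interval → Set
Contained I J = (left J ≤ left I) × (right I ≤ right J)

Overlap : Interval → Interval → Set
Overlap I J = Intersect I J × ¬ Contained I J × ¬ Contained J I

module _ {n : ℕ} (G : ELGraph n) where
  open ELGraph G

  IsIntervalRep : (Fin n → Interval) → Set
  IsIntervalRep I = ∀ u v → u ≢ v →
    (Edge G u v → Intersect (I u) (I v)) × (Intersect (I u) (I v) → Edge G u v)

  IsConsistent : (Fin n → Interval) → Set
  IsConsistent I = ∀ u v →
    (Overlap (I u) (I v) → OvlEdge G u v) × (OvlEdge G u v → Overlap (I u) (I v))

  HasConsistentIntervalRep : Set
  HasConsistentIntervalRep = ∃ λ I → IsIntervalRep I × IsConsistent I

{-# OPTIONS --safe #-}

-- Given a consistent representation, sort the vertices by left end, longer intervals first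
-- among equal left ends: each forbidden pattern then contradicts the order of the endpoints.
-- Conversely, given an interval ordering, let u's interval start at |{v : v ≤ u}| and end
-- at |{v : v ≤ u or v ~ u}|.  By (i) the latter set is an initial segment, so intervals meet
-- exactly along edges, and (ii), (iii) order the right ends of nested and overlapping
-- neighbours.  Equal right ends are separated by ranking in the relation "u ends before v"
-- (an overlap edge with u first, or an inclusion edge with v first), which (iv), (v) make
-- transitive; endpoints are scaled by n + 1 so that the tie-break stays below one unit.
module Submission where

open import Defs
open import Data.Nat using (ℕ)
open import Function.Bundles using (_⇔_; mk⇔)

open import Level using (Level)
open import Data.Nat as ℕ using (suc; _+_; _*_; _<_; _≤_)
open import Data.Nat.Properties as ℕP using (<-cmp; ≤-total; <⇒≱; m≤m+n)
open import Data.Fin as F using (Fin; toℕ)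
import Data.Fin.Properties as FP
open import Data.Fin.Subset as Sub using (Subset; ∣_∣)
open import Data.Fin.Subset.Properties using (p⊆q⇒∣p∣≤∣q∣; p⊂q⇒∣p∣<∣q∣; ∣⊤∣≡n; ∈⊤)
open import Data.Fin.Permutation using (Permutation′; _⟨$⟩ʳ_; permutation)
open import Data.Vec using (tabulate)
open import Data.Vec.Properties using (lookup∘tabulate; []=⇒lookup; lookup⇒[]=)
open import Data.Product using (_×_; _,_; proj₁; proj₂; ∃)
open import Data.Sum using (_⊎_; inj₁; inj₂; swap; fromInj₁)
open import Data.Empty using (⊥-elim)
open import Function using (_∘_; _on_; flip)
open import Function.Bundles using (Injection)
open import Function.Definitions using (Injective)
open import Function.Properties.Inverse using (Inverse⇒Injection)
open import Relation.Nullary using (¬_; Dec; yes; no; does; proof; contradiction)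
open import Relation.Nullary.Decidable using (dec-true; _⊎-dec_; _×-dec_)
open import Relation.Nullary.Reflects using (Reflects; invert)
open import Relation.Unary using (Pred; _⊆_)
import Relation.Unary as U
open import Relation.Binary
  using (Rel; Decidable; Irreflexive; Transitive; Symmetric; DecidableEquality; IsStrictTotalOrder; tri<; tri≈; tri>)
open import Data.Maybe using (just; nothing)
open import Data.Maybe.Properties using (≡-dec)
open import Data.Integer as ℤ using (+_)
import Data.Integer.Properties as ℤP
open import Data.Rational as ℚ using (ℚ)
open import Data.Rational.Literals using (fromℤ)
import Data.Rational.Properties as ℚP
open import Data.Product.Relation.Binary.Pointwise.NonDependent using (Pointwise)
open import Data.Product.Relation.Binary.Lex.Strict using (×-Lex; ×-isStrictTotalOrder)
import Relation.Binary.Construct.Flip.EqAndOrd as Flip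
open import Relation.Binary.PropositionalEquality using (_≡_; _≢_; refl; sym; trans; cong; subst; subst₂)

private
  variable
    p q ℓ : Level
    n : ℕ

module _ {P : Pred (Fin n) p} (P? : U.Decidable P) where

  toSubset : Subset n
  toSubset = tabulate (does ∘ P?)

  count : ℕ
  count = ∣ toSubset ∣

  ∈-toSubset⁺ : ∀ {x} → P x → x Sub.∈ toSubset
  ∈-toSubset⁺ {x} px = lookup⇒[]= x _ (trans (lookup∘tabulate _ x) (dec-true (P? x) px))

  ∈-toSubset⁻ : ∀ {x} → x Sub.∈ toSubset → P x
  ∈-toSubset⁻ {x} x∈ =
    invert (subst (Reflects (P x)) (trans (sym (lookup∘tabulate _ x)) ([]=⇒lookup x∈)) (proof (P? x)))

module _ {P : Pred (Fin n) p} {Q : Pred (Fin n) q} (P? : U.Decidable P) (Q? : U.Decidable Q) where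

  count-mono : P ⊆ Q → count P? ≤ count Q?
  count-mono P⊆Q = p⊆q⇒∣p∣≤∣q∣ (λ x∈P → ∈-toSubset⁺ Q? (P⊆Q (∈-toSubset⁻ P? x∈P)))

  count-mono-< : P ⊆ Q → ∀ {x} → Q x → ¬ P x → count P? < count Q?
  count-mono-< P⊆Q {x} qx ¬px = p⊂q⇒∣p∣<∣q∣
    ( (λ x∈P → ∈-toSubset⁺ Q? (P⊆Q (∈-toSubset⁻ P? x∈P)))
    , x , ∈-toSubset⁺ Q? qx , ¬px ∘ ∈-toSubset⁻ P? )

count<n : {P : Pred (Fin n) p} (P? : U.Decidable P) → ∀ {x} → ¬ P x → count P? < n
count<n {n = n} P? {x} ¬px =
  subst (count P? <_) (∣⊤∣≡n n)
        (p⊂q⇒∣p∣<∣q∣ ((λ _ → ∈⊤) , x , ∈⊤ , ¬px ∘ ∈-toSubset⁻ P?))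

module _ (f : Fin n → ℕ) where

  DownClosed : Pred (Fin n) p → Set p
  DownClosed A = ∀ {x y} → A y → f x ≤ f y → A x

  -- Down-closed sets of a total preorder form a chain, so they are ordered by size.
  downClosed-count-≤⇒⊆ : {A : Pred (Fin n) p} {B : Pred (Fin n) q}
                         (A? : U.Decidable A) (B? : U.Decidable B) →
                         DownClosed A → DownClosed B → count A? ≤ count B? → A ⊆ B
  downClosed-count-≤⇒⊆ {A = A} {B} A? B? A↓ B↓ #A≤#B {x} ax with B? x
  ... | yes bx = bx
  ... | no ¬bx = contradiction #A≤#B (<⇒≱ (count-mono-< B? A? B⊆A ax ¬bx))
    where
    B⊆A : B ⊆ A
    B⊆A {y} by with ≤-total (f y) (f x)
    ... | inj₁ fy≤fx = A↓ ax fy≤fx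
    ... | inj₂ fx≤fy = contradiction (B↓ by fx≤fy) ¬bx

module Rank {_⊏_ : Rel (Fin n) ℓ} (_⊏?_ : Decidable _⊏_)
            (⊏-irrefl : Irreflexive _≡_ _⊏_) (⊏-trans : Transitive _⊏_) where

  rank : Fin n → ℕ
  rank u = count (_⊏? u)

  rank-mono : ∀ {u v} → u ⊏ v → rank u < rank v
  rank-mono {u} {v} u⊏v =
    count-mono-< (_⊏? u) (_⊏? v) (λ w⊏u → ⊏-trans w⊏u u⊏v) u⊏v (⊏-irrefl refl)

  rank<n : ∀ u → rank u < n
  rank<n u = count<n (_⊏? u) (⊏-irrefl refl)

injective⇒surjective : {f : Fin n → Fin n} → Injective _≡_ _≡_ f → ∀ j → ∃ λ i → f i ≡ j
injective⇒surjective {n = suc m} {f} f-inj j with FP.any? (λ i → f i FP.≟ j)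
... | yes hit = hit
... | no miss = contradiction (FP.injective⇒≤ g-inj) ℕP.1+n≰n
  where
  j≢f : ∀ i → j ≢ f i
  j≢f i j≡fi = miss (i , sym j≡fi)
  -- f misses j, so punching j out of its codomain gives an injection Fin (suc m) → Fin m
  g : Fin (suc m) → Fin m
  g i = F.punchOut (j≢f i)
  g-inj : Injective _≡_ _≡_ g
  g-inj {x} {y} eq = f-inj (FP.punchOut-injective (j≢f x) (j≢f y) eq)

injective⇒permutation : (f : Fin n → Fin n) → Injective _≡_ _≡_ f →
                        ∃ λ (π : Permutation′ n) → ∀ u → π ⟨$⟩ʳ u ≡ f u
injective⇒permutation f f-inj = permutation f f⁻¹ f∘f⁻¹ f⁻¹∘f , λ _ → refl
  where
  f⁻¹ : Fin _ → Fin _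
  f⁻¹ j = proj₁ (injective⇒surjective f-inj j)
  f∘f⁻¹ : ∀ j → f (f⁻¹ j) ≡ j
  f∘f⁻¹ j = proj₂ (injective⇒surjective f-inj j)
  f⁻¹∘f : ∀ i → f⁻¹ (f i) ≡ i
  f⁻¹∘f i = f-inj (f∘f⁻¹ (f i))

module _ {a ℓ₁ ℓ₂} {A : Set a} {_≈_ : Rel A ℓ₁} {_<ₐ_ : Rel A ℓ₂}
         (sto : IsStrictTotalOrder _≈_ _<ₐ_)
         (key : Fin n → A) (key-injective : Injective _≡_ _≈_ key) where
  open IsStrictTotalOrder sto using (compare; _<?_; module Eq) renaming (irrefl to <-irrefl; trans to <-trans)

  private
    _⊏_ : Rel (Fin n) ℓ₂
    _⊏_ = _<ₐ_ on key

    _⊏?_ : Decidable _⊏_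
    u ⊏? v = key u <? key v

    ⊏-irrefl : Irreflexive _≡_ _⊏_
    ⊏-irrefl refl = <-irrefl Eq.refl

    open Rank _⊏?_ ⊏-irrefl <-trans

    rankFin : Fin n → Fin n
    rankFin u = F.fromℕ< (rank<n u)

    toℕ-rankFin : ∀ u → toℕ (rankFin u) ≡ rank u
    toℕ-rankFin u = FP.toℕ-fromℕ< (rank<n u)

    rank-reflects : ∀ {u v} → rank u < rank v → u ⊏ v
    rank-reflects {u} {v} ru<rv with compare (key u) (key v)
    ... | tri< u⊏v _ _ = u⊏v
    ... | tri≈ _ ku≈kv _ = contradiction ru<rv (ℕP.<-irrefl (cong rank (key-injective ku≈kv)))
    ... | tri> _ _ v⊏u = contradiction (rank-mono v⊏u) (ℕP.<-asym ru<rv)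

    rank-injective : Injective _≡_ _≡_ rank
    rank-injective {u} {v} ru≡rv with compare (key u) (key v)
    ... | tri< u⊏v _ _ = contradiction ru≡rv (ℕP.<⇒≢ (rank-mono u⊏v))
    ... | tri≈ _ ku≈kv _ = key-injective ku≈kv
    ... | tri> _ _ v⊏u = contradiction (sym ru≡rv) (ℕP.<⇒≢ (rank-mono v⊏u))

    rankFin-injective : Injective _≡_ _≡_ rankFin
    rankFin-injective {u} {v} eq =
      rank-injective (trans (sym (toℕ-rankFin u)) (trans (cong toℕ eq) (toℕ-rankFin v)))

  sortBy : ∃ λ (π : Permutation′ n) → ∀ {u v} → π ⟨$⟩ʳ u F.< π ⟨$⟩ʳ v → key u <ₐ key v
  sortBy with injective⇒permutation rankFin rankFin-injective
  ... | π , π≗rankFin =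
    π , λ {u} {v} πu<πv → rank-reflects (subst₂ _<_ (toℕ-π u) (toℕ-π v) πu<πv)
    where
    toℕ-π : ∀ w → toℕ (π ⟨$⟩ʳ w) ≡ rank w
    toℕ-π w = trans (cong toℕ (π≗rankFin w)) (toℕ-rankFin w)

intersect-sym : ∀ {I J} → Intersect I J → Intersect J I
intersect-sym (lI≤rJ , lJ≤rI) = lJ≤rI , lI≤rJ

overlap-sym : ∀ {I J} → Overlap I J → Overlap J I
overlap-sym {I} {J} (I∩J , I⊈J , J⊈I) = intersect-sym {I} {J} I∩J , J⊈I , I⊈J

¬overlap-refl : ∀ {I} → ¬ Overlap I I
¬overlap-refl (_ , I⊈I , _) = I⊈I (ℚP.≤-refl , ℚP.≤-refl)

ℚ<⇒≱ : ∀ {p q} → p ℚ.< q → ¬ q ℚ.≤ p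
ℚ<⇒≱ p<q q≤p = ℚP.<-irrefl refl (ℚP.<-≤-trans p<q q≤p)

ℕ→ℚ : ℕ → ℚ
ℕ→ℚ m = fromℤ (+ m)

ℕ→ℚ-mono-≤ : ∀ {m k} → m ≤ k → ℕ→ℚ m ℚ.≤ ℕ→ℚ k
ℕ→ℚ-mono-≤ {m} {k} m≤k =
  ℚ.*≤* (subst₂ ℤ._≤_ (sym (ℤP.*-identityʳ (+ m))) (sym (ℤP.*-identityʳ (+ k))) (ℤ.+≤+ m≤k))

ℕ→ℚ-cancel-≤ : ∀ {m k} → ℕ→ℚ m ℚ.≤ ℕ→ℚ k → m ≤ k
ℕ→ℚ-cancel-≤ {m} {k} (ℚ.*≤* m≤k) =
  ℤP.drop‿+≤+ (subst₂ ℤ._≤_ (ℤP.*-identityʳ (+ m)) (ℤP.*-identityʳ (+ k)) m≤k)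

-- N * x + ρ with ρ < N is the two-digit base-N numeral xρ
leading-digit-< : ∀ N {x y ρ σ} → ρ < N → x < y → N * x + ρ < N * y + σ
leading-digit-< N {x} {y} {ρ} {σ} ρ<N x<y = begin-strict
  N * x + ρ  <⟨ ℕP.+-monoʳ-< (N * x) ρ<N ⟩
  N * x + N  ≡⟨ ℕP.+-comm (N * x) N ⟩
  N + N * x  ≡⟨ ℕP.*-suc N x ⟨
  N * suc x  ≤⟨ ℕP.*-monoʳ-≤ N x<y ⟩
  N * y      ≤⟨ m≤m+n (N * y) σ ⟩
  N * y + σ  ∎
  where open ℕP.≤-Reasoning

leading-digit-≤⁻¹ : ∀ N {x y ρ} → ρ < N → N * x ≤ N * y + ρ → x ≤ y
leading-digit-≤⁻¹ N {x} {y} {ρ} ρ<N Nx≤Ny+ρ = ℕP.≮⇒≥ λ y<x →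
  <⇒≱ (leading-digit-< N {σ = 0} ρ<N y<x)
      (subst (_≤ N * y + ρ) (sym (ℕP.+-identityʳ (N * x))) Nx≤Ny+ρ)

_≟ₗ_ : DecidableEquality Label
incl ≟ₗ incl = yes refl
incl ≟ₗ ovl = no λ ()
ovl ≟ₗ incl = no λ ()
ovl ≟ₗ ovl = yes refl

module _ (G : ELGraph n) where
  open ELGraph G

  edge-or-nonEdge : ∀ u v → Edge G u v ⊎ NonEdge G u v
  edge-or-nonEdge u v with lab u v
  ... | just l = inj₁ (l , refl)
  ... | nothing = inj₂ refl

  nonEdge⇒¬edge : ∀ {u v} → NonEdge G u v → ¬ Edge G u v
  nonEdge⇒¬edge u≁v (_ , u~v) with trans (sym u≁v) u~v
  ... | ()

  edge? : ∀ u v → Dec (Edge G u v)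
  edge? u v with edge-or-nonEdge u v
  ... | inj₁ u~v = yes u~v
  ... | inj₂ u≁v = no (nonEdge⇒¬edge u≁v)

  edge-sym : ∀ {u v} → Edge G u v → Edge G v u
  edge-sym {u} {v} (l , uv≡l) = l , trans (lab-sym v u) uv≡l

  ovlEdge-sym : ∀ {u v} → OvlEdge G u v → OvlEdge G v u
  ovlEdge-sym {u} {v} ovl-uv = trans (lab-sym v u) ovl-uv

  inclEdge⇒¬ovlEdge : ∀ {u v} → InclEdge G u v → ¬ OvlEdge G u v
  inclEdge⇒¬ovlEdge incl-uv ovl-uv with trans (sym incl-uv) ovl-uv
  ... | ()

module FromRepresentation (G : ELGraph n) (I : Fin n → Interval)
                          (rep : IsIntervalRep G I) (cons : IsConsistent G I) where

  L R : Fin n → ℚ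
  L u = left (I u)
  R u = right (I u)

  Key : Set
  Key = ℚ × ℚ × ℕ

  _<ₖ_ : Rel Key _
  _<ₖ_ = ×-Lex _≡_ ℚ._<_ (×-Lex _≡_ (flip ℚ._<_) ℕ._<_)

  <ₖ-isStrictTotalOrder : IsStrictTotalOrder (Pointwise _≡_ (Pointwise _≡_ _≡_)) _<ₖ_
  <ₖ-isStrictTotalOrder = ×-isStrictTotalOrder ℚP.<-isStrictTotalOrder
    (×-isStrictTotalOrder (Flip.isStrictTotalOrder ℚP.<-isStrictTotalOrder) ℕP.<-isStrictTotalOrder)

  key : Fin n → Key
  key u = L u , R u , toℕ u

  key-injective : Injective _≡_ (Pointwise _≡_ (Pointwise _≡_ _≡_)) key
  key-injective (_ , _ , index≡) = FP.toℕ-injective index≡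

  _⊏_ : Rel (Fin n) _
  u ⊏ v = key u <ₖ key v

  ⊏⇒≢ : ∀ {u v} → u ⊏ v → u ≢ v
  ⊏⇒≢ u⊏v refl = IsStrictTotalOrder.irrefl <ₖ-isStrictTotalOrder (refl , refl , refl) u⊏v

  ⊏⇒L≤ : ∀ {u v} → u ⊏ v → L u ℚ.≤ L v
  ⊏⇒L≤ (inj₁ Lu<Lv) = ℚP.<⇒≤ Lu<Lv
  ⊏⇒L≤ (inj₂ (Lu≡Lv , _)) = ℚP.≤-reflexive Lu≡Lv

  ⊏⇒sameL⇒R≥ : ∀ {u v} → u ⊏ v → L u ≡ L v → R v ℚ.≤ R u
  ⊏⇒sameL⇒R≥ (inj₁ Lu<Lv) Lu≡Lv = contradiction Lu<Lv (ℚP.<-irrefl Lu≡Lv)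
  ⊏⇒sameL⇒R≥ (inj₂ (_ , inj₁ Rv<Ru)) _ = ℚP.<⇒≤ Rv<Ru
  ⊏⇒sameL⇒R≥ (inj₂ (_ , inj₂ (Ru≡Rv , _))) _ = ℚP.≤-reflexive (sym Ru≡Rv)

  nonEdge⇒R<L : ∀ {u v} → u ⊏ v → NonEdge G u v → R u ℚ.< L v
  nonEdge⇒R<L {u} {v} u⊏v u≁v = ℚP.≰⇒> λ Lv≤Ru →
    nonEdge⇒¬edge G u≁v
      (proj₂ (rep u v (⊏⇒≢ u⊏v)) (ℚP.≤-trans (⊏⇒L≤ u⊏v) (left≤right (I v)) , Lv≤Ru))

  ovlEdge⇒R< : ∀ {u v} → u ⊏ v → OvlEdge G u v → R u ℚ.< R v
  ovlEdge⇒R< {u} {v} u⊏v ovl-uv = ℚP.≰⇒> λ Rv≤Ru → v⊈u (⊏⇒L≤ u⊏v , Rv≤Ru)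
    where
    v⊈u : ¬ Contained (I v) (I u)
    v⊈u = proj₂ (proj₂ (proj₂ (cons u v) ovl-uv))

  inclEdge⇒contained : ∀ {u v} → u ⊏ v → InclEdge G u v → Contained (I v) (I u)
  inclEdge⇒contained {u} {v} u⊏v incl-uv with R v ℚP.≤? R u
  ... | yes Rv≤Ru = ⊏⇒L≤ u⊏v , Rv≤Ru
  ... | no Rv≰Ru = contradiction (proj₁ (cons u v) u⋈v) (inclEdge⇒¬ovlEdge G incl-uv)
    where
    u⋈v : Overlap (I u) (I v)
    u⋈v = proj₁ (rep u v (⊏⇒≢ u⊏v)) (incl , incl-uv)
        , (λ u⊆v → Rv≰Ru (⊏⇒sameL⇒R≥ u⊏v (ℚP.≤-antisym (⊏⇒L≤ u⊏v) (proj₁ u⊆v))))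
        , (λ v⊆u → Rv≰Ru (proj₂ v⊆u))

  ⊏-trans : Transitive _⊏_
  ⊏-trans = IsStrictTotalOrder.trans <ₖ-isStrictTotalOrder

  edge⇒L≤R : ∀ {u v} → u ≢ v → Edge G u v → L v ℚ.≤ R u
  edge⇒L≤R {u} {v} u≢v u~v = proj₂ (proj₁ (rep u v u≢v) u~v)

  ⊏-noForbidden : ∀ {a b c} → a ⊏ b → b ⊏ c → ¬ Forbidden G a b c
  ⊏-noForbidden a⊏b b⊏c (inj₁ (a≁b , a~c)) =
    ℚ<⇒≱ (nonEdge⇒R<L a⊏b a≁b)
         (ℚP.≤-trans (⊏⇒L≤ b⊏c) (edge⇒L≤R (⊏⇒≢ (⊏-trans a⊏b b⊏c)) a~c))
  ⊏-noForbidden a⊏b b⊏c (inj₂ (inj₁ (incl-ab , a≁c , b~c))) =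
    ℚ<⇒≱ (nonEdge⇒R<L (⊏-trans a⊏b b⊏c) a≁c)
         (ℚP.≤-trans (edge⇒L≤R (⊏⇒≢ b⊏c) b~c) (proj₂ (inclEdge⇒contained a⊏b incl-ab)))
  ⊏-noForbidden a⊏b b⊏c (inj₂ (inj₂ (inj₁ (ovl-ab , a~c , b≁c)))) =
    ℚ<⇒≱ (nonEdge⇒R<L b⊏c b≁c)
         (ℚP.≤-trans (edge⇒L≤R (⊏⇒≢ (⊏-trans a⊏b b⊏c)) a~c) (ℚP.<⇒≤ (ovlEdge⇒R< a⊏b ovl-ab)))
  ⊏-noForbidden a⊏b b⊏c (inj₂ (inj₂ (inj₂ (inj₁ (ovl-ab , ovl-bc , incl-ac))))) =
    ℚ<⇒≱ (ℚP.<-trans (ovlEdge⇒R< a⊏b ovl-ab) (ovlEdge⇒R< b⊏c ovl-bc))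
         (proj₂ (inclEdge⇒contained (⊏-trans a⊏b b⊏c) incl-ac))
  ⊏-noForbidden {a} {b} {c} a⊏b b⊏c (inj₂ (inj₂ (inj₂ (inj₂ (incl-ab , incl-bc , ovl-ac))))) =
    c⊈a (ℚP.≤-trans (proj₁ a⊇b) (proj₁ b⊇c) , ℚP.≤-trans (proj₂ b⊇c) (proj₂ a⊇b))
    where
    a⊇b : Contained (I b) (I a)
    a⊇b = inclEdge⇒contained a⊏b incl-ab
    b⊇c : Contained (I c) (I b)
    b⊇c = inclEdge⇒contained b⊏c incl-bc
    c⊈a : ¬ Contained (I c) (I a)
    c⊈a = proj₂ (proj₂ (proj₂ (cons a c) ovl-ac))

  sorting : ∃ λ (π : Permutation′ n) → ∀ {u v} → π ⟨$⟩ʳ u F.< π ⟨$⟩ʳ v → u ⊏ v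
  sorting = sortBy <ₖ-isStrictTotalOrder key key-injective

  intervalOrdering : HasIntervalOrdering G
  intervalOrdering =
    let π , sorted = sorting in
    π , λ a b c a≺b b≺c → ⊏-noForbidden {a} {b} {c} (sorted a≺b) (sorted b≺c)

module FromOrdering (G : ELGraph n) (π : Permutation′ n) (io : IsIntervalOrdering G π) where
  open ELGraph G

  pos : Fin n → ℕ
  pos u = toℕ (π ⟨$⟩ʳ u)

  _≺_ : Rel (Fin n) _
  u ≺ v = pos u < pos v

  pos-injective : ∀ {u v} → pos u ≡ pos v → u ≡ v
  pos-injective = Injection.injective (Inverse⇒Injection π) ∘ FP.toℕ-injective

  ≺-wlog : {P : Rel (Fin n) ℓ} → Symmetric P →
           (∀ {u v} → u ≺ v → P u v) → ∀ {u v} → u ≢ v → P u v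
  ≺-wlog P-sym P-≺ {u} {v} u≢v with <-cmp (pos u) (pos v)
  ... | tri< u≺v _ _ = P-≺ u≺v
  ... | tri≈ _ pu≡pv _ = contradiction (pos-injective pu≡pv) u≢v
  ... | tri> _ _ v≺u = P-sym (P-≺ v≺u)

  io-i : ∀ {a b c} → a ≺ b → b ≺ c → Edge G a c → Edge G a b
  io-i {a} {b} {c} a≺b b≺c a~c with edge-or-nonEdge G a b
  ... | inj₁ a~b = a~b
  ... | inj₂ a≁b = ⊥-elim (io a b c a≺b b≺c (inj₁ (a≁b , a~c)))

  io-ii : ∀ {a b c} → a ≺ b → b ≺ c → InclEdge G a b → Edge G b c → Edge G a c
  io-ii {a} {b} {c} a≺b b≺c incl-ab b~c with edge-or-nonEdge G a c
  ... | inj₁ a~c = a~c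
  ... | inj₂ a≁c = ⊥-elim (io a b c a≺b b≺c (inj₂ (inj₁ (incl-ab , a≁c , b~c))))

  io-iii : ∀ {a b c} → a ≺ b → b ≺ c → OvlEdge G a b → Edge G a c → Edge G b c
  io-iii {a} {b} {c} a≺b b≺c ovl-ab a~c with edge-or-nonEdge G b c
  ... | inj₁ b~c = b~c
  ... | inj₂ b≁c = ⊥-elim (io a b c a≺b b≺c (inj₂ (inj₂ (inj₁ (ovl-ab , a~c , b≁c)))))

  io-iv : ∀ {a b c} → a ≺ b → b ≺ c → OvlEdge G a b → OvlEdge G b c → ¬ InclEdge G a c
  io-iv {a} {b} {c} a≺b b≺c ovl-ab ovl-bc incl-ac =
    io a b c a≺b b≺c (inj₂ (inj₂ (inj₂ (inj₁ (ovl-ab , ovl-bc , incl-ac)))))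

  io-v : ∀ {a b c} → a ≺ b → b ≺ c → InclEdge G a b → InclEdge G b c → ¬ OvlEdge G a c
  io-v {a} {b} {c} a≺b b≺c incl-ab incl-bc ovl-ac =
    io a b c a≺b b≺c (inj₂ (inj₂ (inj₂ (inj₂ (incl-ab , incl-bc , ovl-ac)))))

  -- In the representation built below, Reaches u v means that u's interval reaches v's left end.
  Reaches : Rel (Fin n) _
  Reaches u v = pos v ≤ pos u ⊎ Edge G u v

  reaches? : ∀ u → U.Decidable (Reaches u)
  reaches? u v = pos v ℕ.≤? pos u ⊎-dec edge? G u v

  below? : ∀ u → U.Decidable (λ v → pos v ≤ pos u)
  below? u v = pos v ℕ.≤? pos u

  start reach : Fin n → ℕ
  start u = count (below? u)
  reach u = count (reaches? u)

  reaches-downClosed : ∀ u → DownClosed pos (Reaches u)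
  reaches-downClosed u (inj₁ y≤u) x≤y = inj₁ (ℕP.≤-trans x≤y y≤u)
  reaches-downClosed u {x} {y} (inj₂ u~y) x≤y with pos x ℕ.≤? pos u | ℕP.m≤n⇒m<n∨m≡n x≤y
  ... | yes x≤u | _ = inj₁ x≤u
  ... | no x≰u | inj₁ x≺y = inj₂ (io-i (ℕP.≰⇒> x≰u) x≺y u~y)
  ... | no _ | inj₂ px≡py rewrite pos-injective px≡py = inj₂ u~y

  start-mono : ∀ {u v} → u ≺ v → start u < start v
  start-mono {u} {v} u≺v =
    count-mono-< (below? u) (below? v) (λ w≤u → ℕP.≤-trans w≤u (ℕP.<⇒≤ u≺v)) ℕP.≤-refl (<⇒≱ u≺v)

  start≤reach : ∀ u → start u ≤ reach u
  start≤reach u = count-mono (below? u) (reaches? u) inj₁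

  edge⇒start≤reach : ∀ {u v} → Edge G u v → start v ≤ reach u
  edge⇒start≤reach {u} {v} u~v =
    count-mono (below? v) (reaches? u) (λ w≤v → reaches-downClosed u (inj₂ u~v) w≤v)

  reaches⇒edge : ∀ {u v} → u ≺ v → Reaches u v → Edge G u v
  reaches⇒edge u≺v (inj₁ v≤u) = contradiction v≤u (<⇒≱ u≺v)
  reaches⇒edge u≺v (inj₂ u~v) = u~v

  start≤reach⇒edge : ∀ {u v} → u ≺ v → start v ≤ reach u → Edge G u v
  start≤reach⇒edge {u} {v} u≺v sv≤ru = reaches⇒edge u≺v
    (downClosed-count-≤⇒⊆ pos (below? v) (reaches? u)
      (λ y≤v x≤y → ℕP.≤-trans x≤y y≤v) (reaches-downClosed u) sv≤ru ℕP.≤-refl)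

  inclEdge⇒reach≥ : ∀ {u v} → u ≺ v → InclEdge G u v → reach v ≤ reach u
  inclEdge⇒reach≥ {u} {v} u≺v incl-uv = count-mono (reaches? v) (reaches? u) v⇝⇒u⇝
    where
    v⇝⇒u⇝ : Reaches v ⊆ Reaches u
    v⇝⇒u⇝ {w} v⇝w with pos w ℕ.≤? pos v | v⇝w
    ... | yes w≤v | _ = reaches-downClosed u (inj₂ (incl , incl-uv)) w≤v
    ... | no w≰v | inj₁ w≤v = contradiction w≤v w≰v
    ... | no w≰v | inj₂ v~w = inj₂ (io-ii u≺v (ℕP.≰⇒> w≰v) incl-uv v~w)

  ovlEdge⇒reach≤ : ∀ {u v} → u ≺ v → OvlEdge G u v → reach u ≤ reach v
  ovlEdge⇒reach≤ {u} {v} u≺v ovl-uv = count-mono (reaches? u) (reaches? v) u⇝⇒v⇝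
    where
    u⇝⇒v⇝ : Reaches u ⊆ Reaches v
    u⇝⇒v⇝ {w} u⇝w with pos w ℕ.≤? pos v | u⇝w
    ... | yes w≤v | _ = inj₁ w≤v
    ... | no w≰v | inj₁ w≤u = contradiction (ℕP.≤-trans w≤u (ℕP.<⇒≤ u≺v)) w≰v
    ... | no w≰v | inj₂ u~w = inj₂ (io-iii u≺v (ℕP.≰⇒> w≰v) ovl-uv u~w)

  sameReach⇒edge : ∀ {u v} → u ≢ v → reach u ≡ reach v → Edge G u v
  sameReach⇒edge = ≺-wlog (λ P-uv ru≡rv → edge-sym G (P-uv (sym ru≡rv))) λ {u} {v} u≺v ru≡rv →
    reaches⇒edge u≺v (downClosed-count-≤⇒⊆ pos (reaches? v) (reaches? u)
      (reaches-downClosed v) (reaches-downClosed u) (ℕP.≤-reflexive (sym ru≡rv)) (inj₁ ℕP.≤-refl))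

  EndsBefore : Rel (Fin n) _
  EndsBefore u v = (u ≺ v × OvlEdge G u v) ⊎ (v ≺ u × InclEdge G v u)

  pattern overlapping u≺v ovl-uv = inj₁ (u≺v , ovl-uv)
  pattern nested v≺u incl-vu = inj₂ (v≺u , incl-vu)

  endsBefore? : Decidable EndsBefore
  endsBefore? u v = (pos u ℕ.<? pos v ×-dec ≡-dec _≟ₗ_ (lab u v) (just ovl))
             ⊎-dec (pos v ℕ.<? pos u ×-dec ≡-dec _≟ₗ_ (lab v u) (just incl))

  endsBefore⇒reach≤ : ∀ {u v} → EndsBefore u v → reach u ≤ reach v
  endsBefore⇒reach≤ (overlapping u≺v ovl-uv) = ovlEdge⇒reach≤ u≺v ovl-uv
  endsBefore⇒reach≤ (nested v≺u incl-vu) = inclEdge⇒reach≥ v≺u incl-vu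

  endsBefore-asym : ∀ {u v} → EndsBefore u v → ¬ EndsBefore v u
  endsBefore-asym (overlapping u≺v _) (overlapping v≺u _) = ℕP.<-asym u≺v v≺u
  endsBefore-asym (overlapping _ ovl-uv) (nested _ incl-uv) = inclEdge⇒¬ovlEdge G incl-uv ovl-uv
  endsBefore-asym (nested _ incl-vu) (overlapping _ ovl-vu) = inclEdge⇒¬ovlEdge G incl-vu ovl-vu
  endsBefore-asym (nested v≺u _) (nested u≺v _) = ℕP.<-asym u≺v v≺u

  -- Each of the six relative positions of x, y, z makes a 3-cycle one of the patterns (iv), (v).
  endsBefore-no3cycle : ∀ {x y z} → EndsBefore x y → EndsBefore y z → ¬ EndsBefore z x
  endsBefore-no3cycle (overlapping x≺y _) (overlapping y≺z _) (overlapping z≺x _) =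
    ℕP.<-asym (ℕP.<-trans x≺y y≺z) z≺x
  endsBefore-no3cycle (overlapping x≺y xy) (overlapping y≺z yz) (nested _ xz) = io-iv x≺y y≺z xy yz xz
  endsBefore-no3cycle (overlapping x≺y xy) (nested z≺y zy) (overlapping z≺x zx) = io-iv z≺x x≺y zx xy zy
  endsBefore-no3cycle (overlapping _ xy) (nested z≺y zy) (nested x≺z xz) = io-v x≺z z≺y xz zy xy
  endsBefore-no3cycle (nested y≺x yx) (overlapping y≺z yz) (overlapping z≺x zx) = io-iv y≺z z≺x yz zx yx
  endsBefore-no3cycle (nested y≺x yx) (overlapping _ yz) (nested x≺z xz) = io-v y≺x x≺z yx xz yz
  endsBefore-no3cycle (nested y≺x yx) (nested z≺y zy) (overlapping _ zx) = io-v z≺y y≺x zy yx zx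
  endsBefore-no3cycle (nested y≺x _) (nested z≺y _) (nested x≺z _) =
    ℕP.<-asym (ℕP.<-trans y≺x x≺z) z≺y

  endsBefore-connex : ∀ {u v} → u ≢ v → Edge G u v → EndsBefore u v ⊎ EndsBefore v u
  endsBefore-connex = ≺-wlog (λ P-uv v~u → swap (P-uv (edge-sym G v~u))) endsBefore-≺
    where
    endsBefore-≺ : ∀ {u v} → u ≺ v → Edge G u v → EndsBefore u v ⊎ EndsBefore v u
    endsBefore-≺ u≺v (ovl , ovl-uv) = inj₁ (overlapping u≺v ovl-uv)
    endsBefore-≺ u≺v (incl , incl-uv) = inj₂ (nested u≺v incl-uv)

  -- Vertices with the same reach are pairwise adjacent, and there EndsBefore is a strict total order.
  _◁_ : Rel (Fin n) _
  u ◁ v = reach u ≡ reach v × EndsBefore u v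

  ◁-irrefl : Irreflexive _≡_ _◁_
  ◁-irrefl refl (_ , uu) = endsBefore-asym uu uu

  ◁-trans : Transitive _◁_
  ◁-trans {x} {y} {z} (rx≡ry , xy) (ry≡rz , yz) = rx≡rz , xz
    where
    rx≡rz : reach x ≡ reach z
    rx≡rz = trans rx≡ry ry≡rz
    x≢z : x ≢ z
    x≢z refl = endsBefore-asym xy yz
    xz : EndsBefore x z
    xz = fromInj₁ (λ zx → contradiction zx (endsBefore-no3cycle xy yz))
                  (endsBefore-connex x≢z (sameReach⇒edge x≢z rx≡rz))

  _◁?_ : Decidable _◁_
  u ◁? v = reach u ℕ.≟ reach v ×-dec endsBefore? u v

  open Rank _◁?_ ◁-irrefl ◁-trans
    renaming (rank to tieBreak; rank-mono to tieBreak-mono; rank<n to tieBreak<n)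

  N : ℕ
  N = suc n

  tieBreak<N : ∀ u → tieBreak u < N
  tieBreak<N u = ℕP.m<n⇒m<1+n (tieBreak<n u)

  leftEnd rightEnd : Fin n → ℕ
  leftEnd u = N * start u
  rightEnd u = N * reach u + tieBreak u

  start≤reach⇒leftEnd≤rightEnd : ∀ {u v} → start v ≤ reach u → leftEnd v ≤ rightEnd u
  start≤reach⇒leftEnd≤rightEnd sv≤ru = ℕP.≤-trans (ℕP.*-monoʳ-≤ N sv≤ru) (m≤m+n _ _)

  leftEnd≤rightEnd⇒start≤reach : ∀ {u v} → leftEnd v ≤ rightEnd u → start v ≤ reach u
  leftEnd≤rightEnd⇒start≤reach {u} = leading-digit-≤⁻¹ N (tieBreak<N u)

  leftEnd-mono : ∀ {u v} → u ≺ v → leftEnd u < leftEnd v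
  leftEnd-mono u≺v = ℕP.*-monoʳ-< N (start-mono u≺v)

  endsBefore⇒rightEnd< : ∀ {u v} → EndsBefore u v → rightEnd u < rightEnd v
  endsBefore⇒rightEnd< {u} {v} uv with ℕP.m≤n⇒m<n∨m≡n (endsBefore⇒reach≤ uv)
  ... | inj₁ ru<rv = leading-digit-< N (tieBreak<N u) ru<rv
  ... | inj₂ ru≡rv = begin-strict
    N * reach u + tieBreak u  <⟨ ℕP.+-monoʳ-< (N * reach u) (tieBreak-mono (ru≡rv , uv)) ⟩
    N * reach u + tieBreak v  ≡⟨ cong (λ r → N * r + tieBreak v) ru≡rv ⟩
    N * reach v + tieBreak v  ∎
    where open ℕP.≤-Reasoning

  interval : Fin n → Interval
  interval u =
    [ ℕ→ℚ (leftEnd u) , ℕ→ℚ (rightEnd u)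
    ∣ ℕ→ℚ-mono-≤ (start≤reach⇒leftEnd≤rightEnd (start≤reach u)) ]

  EdgeRepresented LabelRepresented : Rel (Fin n) _
  EdgeRepresented u v =
    (Edge G u v → Intersect (interval u) (interval v)) × (Intersect (interval u) (interval v) → Edge G u v)
  LabelRepresented u v =
    (Overlap (interval u) (interval v) → OvlEdge G u v) × (OvlEdge G u v → Overlap (interval u) (interval v))

  edgeRepresented-sym : Symmetric EdgeRepresented
  edgeRepresented-sym {u} {v} (e⇒i , i⇒e) =
    (λ v~u → intersect-sym {interval u} {interval v} (e⇒i (edge-sym G v~u))) ,
    (λ v∩u → edge-sym G (i⇒e (intersect-sym {interval v} {interval u} v∩u)))

  labelRepresented-sym : Symmetric LabelRepresented
  labelRepresented-sym {u} {v} (o⇒e , e⇒o) =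
    (λ v⋈u → ovlEdge-sym G (o⇒e (overlap-sym {interval v} {interval u} v⋈u))) ,
    (λ ovl-vu → overlap-sym {interval u} {interval v} (e⇒o (ovlEdge-sym G ovl-vu)))

  edgeRepresented-≺ : ∀ {u v} → u ≺ v → EdgeRepresented u v
  edgeRepresented-≺ {u} {v} u≺v =
    (λ u~v → ℕ→ℚ-mono-≤ lu≤rv , ℕ→ℚ-mono-≤ (start≤reach⇒leftEnd≤rightEnd (edge⇒start≤reach u~v))) ,
    (λ (_ , lv≤ru) →
      start≤reach⇒edge u≺v (leftEnd≤rightEnd⇒start≤reach (ℕ→ℚ-cancel-≤ lv≤ru)))
    where
    lu≤rv : leftEnd u ≤ rightEnd v
    lu≤rv = start≤reach⇒leftEnd≤rightEnd (ℕP.≤-trans (ℕP.<⇒≤ (start-mono u≺v)) (start≤reach v))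

  labelRepresented-≺ : ∀ {u v} → u ≺ v → LabelRepresented u v
  labelRepresented-≺ {u} {v} u≺v = overlap⇒ovlEdge , ovlEdge⇒overlap
    where
    overlap⇒ovlEdge : Overlap (interval u) (interval v) → OvlEdge G u v
    overlap⇒ovlEdge (u∩v , _ , v⊈u) with proj₂ (edgeRepresented-≺ u≺v) u∩v
    ... | ovl , ovl-uv = ovl-uv
    ... | incl , incl-uv =
      contradiction (ℕ→ℚ-mono-≤ (ℕP.<⇒≤ (leftEnd-mono u≺v)) , ℕ→ℚ-mono-≤ (ℕP.<⇒≤ vu)) v⊈u
      where
      vu : rightEnd v < rightEnd u
      vu = endsBefore⇒rightEnd< (nested u≺v incl-uv)
    ovlEdge⇒overlap : OvlEdge G u v → Overlap (interval u) (interval v)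
    ovlEdge⇒overlap ovl-uv =
      proj₁ (edgeRepresented-≺ u≺v) (ovl , ovl-uv) ,
      (λ u⊆v → <⇒≱ (leftEnd-mono u≺v) (ℕ→ℚ-cancel-≤ (proj₁ u⊆v))) ,
      (λ v⊆u →
        <⇒≱ (endsBefore⇒rightEnd< (overlapping u≺v ovl-uv)) (ℕ→ℚ-cancel-≤ (proj₂ v⊆u)))

  isIntervalRep : IsIntervalRep G interval
  isIntervalRep u v = ≺-wlog edgeRepresented-sym edgeRepresented-≺

  isConsistent : IsConsistent G interval
  isConsistent u v with u F.≟ v
  ... | yes refl = (λ u⋈u → contradiction u⋈u (¬overlap-refl {interval u}))
                 , (λ ovl-uu → contradiction ovl-uu (inclEdge⇒¬ovlEdge G (lab-loop u)))
  ... | no u≢v = ≺-wlog labelRepresented-sym labelRepresented-≺ u≢v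

  consistentIntervalRep : HasConsistentIntervalRep G
  consistentIntervalRep = interval , isIntervalRep , isConsistent

lemma24 : ∀ (n : ℕ) (G : ELGraph n) → HasIntervalOrdering G ⇔ HasConsistentIntervalRep G
lemma24 n G = mk⇔ (λ (π , io) → FromOrdering.consistentIntervalRep G π io)
                  (λ (I , rep , cons) → FromRepresentation.intervalOrdering G I rep cons)
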